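{- Let $n$ be a positive integer. Then $\mathsf{NAADT}(\mathsf{OMB}_n)=n$. Moreover, $\mathrm{spar}(\mathsf{OMB}_n)=n$ if $n$ is even, and $\mathrm{spar}(\mathsf{OMB}_n)=n+1$ if $n$ is odd.
   Context: $\mathsf{OMB}_n:\{0,1\}^n\to\{0,1\}$: $\mathsf{OMB}_n(x)=1$ if $\max\{i\in[n]:x_i=0\}$ is odd, $0$ if it is even, and $\mathsf{OMB}_n(1^n)=0$. For $S\subseteq[n]$, $\mathsf{AND}_S(x)=\prod_{i\in S}x_i$. Every $f:\{0,1\}^n\to\{0,1\}$ has a unique real expansion $f=\sum_S\widetilde f(S)\mathsf{AND}_S$, and $\mathrm{spar}(f)=|\{S:\widetilde f(S)\neq0\}|$. $\mathsf{NAADT}(f)$ is the minimum $k$ such that there exist $S_1,\dots,S_k\subseteq[n]$ for which $f(x)$ is determined by $(\mathsf{AND}_{S_1}(x),\dots,\mathsf{AND}_{S_k}(x))$ for all $x$. -}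

module Defs where

open import Data.Bool using (Bool; true; false; if_then_else_; _∧_)
open import Data.Nat using (ℕ; zero; suc; _≡ᵇ_; _%_)
open import Data.Fin using (Fin)
open import Data.Vec using (Vec; []; _∷_; lookup; zipWith; foldr)
open import Data.List using (List; []; _∷_; map; _++_; length; filter)
open import Data.Maybe using (Maybe; just; nothing; maybe)
open import Data.Rational using (ℚ; 0ℚ; 1ℚ; _+_; _*_; _≟_)
open import Relation.Binary.PropositionalEquality using (_≡_)
open import Relation.Nullary using (¬_; ¬?)
open import Data.Product using (Σ; _×_)

-- Inputs x ∈ {0,1}^n are Vec Bool n; false = 0, true = 1.
-- Position (Fin) i corresponds to the coordinate i+1 ∈ [n] = {1,…,n}.
-- Subsets S ⊆ [n] are characteristic vectors Vec Bool n (true = member).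

Subset : ℕ → Set
Subset n = Vec Bool n

allSubsets : (n : ℕ) → List (Subset n)
allSubsets zero = [] ∷ []
allSubsets (suc n) = map (false ∷_) (allSubsets n) ++ map (true ∷_) (allSubsets n)

-- 1-indexed position of the last 0 in x (nothing if x = 1^n)
lastZero : {n : ℕ} → Vec Bool n → Maybe ℕ
lastZero [] = nothing
lastZero (b ∷ xs) with lastZero xs
... | just k = just (suc k)
... | nothing = if b then nothing else just 1

OMB : (n : ℕ) → Vec Bool n → Bool
OMB n x = maybe (λ k → k % 2 ≡ᵇ 1) false (lastZero x)

AND : {n : ℕ} → Subset n → Vec Bool n → Bool
AND S x = foldr _ _∧_ true (zipWith (λ s b → if s then b else true) S x)

toℚ : Bool → ℚ
toℚ b = if b then 1ℚ else 0ℚ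

sumℚ : List ℚ → ℚ
sumℚ [] = 0ℚ
sumℚ (q ∷ qs) = q + sumℚ qs

IsANDExpansion : {n : ℕ} → (Vec Bool n → Bool) → (Subset n → ℚ) → Set
IsANDExpansion {n} f c =
  (x : Vec Bool n) → toℚ (f x) ≡ sumℚ (map (λ S → c S * toℚ (AND S x)) (allSubsets n))

support : {n : ℕ} → (Subset n → ℚ) → ℕ
support {n} c = length (filter (λ S → ¬? (c S ≟ 0ℚ)) (allSubsets n))

-- spar(f) = k : the (unique) AND-expansion of f has exactly k nonzero coefficients.
-- Stated as: some expansion exists, and every expansion has support size k.
SparIs : {n : ℕ} → (Vec Bool n → Bool) → ℕ → Set
SparIs {n} f k =
  Σ (Subset n → ℚ) (λ c → IsANDExpansion f c) ×
  ((c : Subset n → ℚ) → IsANDExpansion f c → support c ≡ k)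

Determines : {n k : ℕ} → Vec (Subset n) k → (Vec Bool n → Bool) → Set
Determines {n} {k} Ss f =
  (x y : Vec Bool n) → ((j : Fin k) → AND (lookup Ss j) x ≡ AND (lookup Ss j) y) → f x ≡ f y

NAADTIs : {n : ℕ} → (Vec Bool n → Bool) → ℕ → Set
NAADTIs {n} f m =
  Σ (Vec (Subset n) m) (λ Ss → Determines Ss f) ×
  ((k : ℕ) (Ss : Vec (Subset n) k) → Determines Ss f → m Data.Nat.≤ k)

-- Prepending a coordinate shifts the position of the last zero by one and so flips its parity,
-- unless there is no zero at all; as real functions this reads
--   OMB (b ∷ x) = 1 − OMB x − b · AND_{[n]} x.
-- Unfolding the recurrence gives an AND-expansion whose nonzero coefficients sit on the n sets
-- {i,…,n} and, when n is odd, on ∅; the AND-monomials are linearly independent, so it is the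
-- only expansion.  For NAADT, the n singletons determine every function.  Conversely, OMB
-- changes value at each of the n steps of the chain 0^j 1^(n−j), j = 0,…,n, while a fixed AND_S
-- is antitone along the chain and so changes at most once: the n steps need n distinct sets.
module Submission where

open import Defs
open import Data.Nat using (ℕ; suc; _+_)
open import Data.Nat.Divisibility using (_∣_)
open import Data.Product using (_×_)
open import Relation.Nullary using (¬_)

open import Algebra.Properties.Group using (x∙y⁻¹≈ε⇒x≈y)
open import Data.Bool using (Bool; true; false; not; _∧_; if_then_else_)
import Data.Bool as Bool
open import Data.Bool.Properties using (∧-zeroʳ; ∧-identityʳ; not-¬)
open import Data.Fin using (Fin; toℕ)
open import Data.Fin.Properties using (injective⇒≤; ¬∀⟶∃¬; toℕ<n; toℕ-injective)
open import Data.Fin.Subset using (⊥; ⊤; ⁅_⁆)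
open import Data.List using (List; []; _∷_; map; _++_; length; filter)
open import Data.List.Properties using (map-++; map-∘; length-++; filter-++; filter-≐; filter-none)
import Data.List.Relation.Unary.All as All
open import Data.Maybe using (just; nothing; maybe)
open import Data.Nat using (zero; _≡ᵇ_; _%_; _≤_; _<_; s≤s)
open import Data.Nat.DivMod using (m%n<n)
open import Data.Nat.Divisibility using (m%n≡0⇒n∣m; n∣m⇒m%n≡0)
open import Data.Nat.Properties using (+-comm; +-suc; ≤-antisym; ≮⇒≥; n≤1+n; <⇒≤)
open import Data.Product using (∃; _,_; proj₁; proj₂)
open import Data.Rational using (ℚ; 0ℚ; 1ℚ; -_; _-_; _≟_) renaming (_+_ to _+ℚ_; _*_ to _*ℚ_)
import Data.Rational.Properties as ℚ
open import Data.Rational.Solver using (module +-*-Solver)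
open import Data.Vec using (Vec; []; _∷_; lookup; tabulate)
open import Data.Vec.Properties
  using (≡-dec; ∷-injectiveʳ; lookup∘tabulate; tabulate∘lookup; tabulate-cong)
open import Function using (_∘_; _⇔_; mk⇔; Equivalence; case_of_)
open import Function.Construct.Symmetry using (⇔-sym)
open import Relation.Nullary using (Dec; yes; no; does; ¬?; contradiction)
open import Relation.Binary.PropositionalEquality

private variable
  A B : Set

isOdd : ℕ → Bool
isOdd k = k % 2 ≡ᵇ 1

isOdd-suc : ∀ k → isOdd (suc k) ≡ not (isOdd k)
isOdd-suc zero = refl
isOdd-suc (suc zero) = refl
isOdd-suc (suc (suc k)) = isOdd-suc k

2∣n⇒isOdd≡false : ∀ {n} → 2 ∣ n → isOdd n ≡ false
2∣n⇒isOdd≡false {n} 2∣n rewrite n∣m⇒m%n≡0 n 2 2∣n = refl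

2∤n⇒isOdd≡true : ∀ {n} → ¬ 2 ∣ n → isOdd n ≡ true
2∤n⇒isOdd≡true {n} 2∤n with n % 2 in n%2 | m%n<n n 2
... | 0 | _ = contradiction (m%n≡0⇒n∣m n 2 n%2) 2∤n
... | 1 | _ = refl
... | suc (suc _) | s≤s (s≤s ())

1-toℚ≡toℚ-not : ∀ b → 1ℚ - toℚ b ≡ toℚ (not b)
1-toℚ≡toℚ-not true = refl
1-toℚ≡toℚ-not false = refl

1≢0 : 1ℚ ≢ 0ℚ
1≢0 ()

-≡0⇔≡0 : ∀ q → (- q ≡ 0ℚ) ⇔ (q ≡ 0ℚ)
-≡0⇔≡0 q = mk⇔ ℚ.neg-injective (cong (λ p → - p))

*-distribʳ-minus : ∀ p q r → (p - q) *ℚ r ≡ p *ℚ r - q *ℚ r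
*-distribʳ-minus = solve 3 (λ p q r → (p :- q) :* r := p :* r :- q :* r) refl
  where open +-*-Solver

sumℚ-++ : (xs ys : List ℚ) → sumℚ (xs ++ ys) ≡ sumℚ xs +ℚ sumℚ ys
sumℚ-++ [] ys = sym (ℚ.+-identityˡ _)
sumℚ-++ (x ∷ xs) ys = trans (cong (x +ℚ_) (sumℚ-++ xs ys)) (sym (ℚ.+-assoc x _ _))

sumℚ-map-cong : {F G : A → ℚ} (xs : List A) → (∀ a → F a ≡ G a) →
  sumℚ (map F xs) ≡ sumℚ (map G xs)
sumℚ-map-cong [] F≗G = refl
sumℚ-map-cong (x ∷ xs) F≗G = cong₂ _+ℚ_ (F≗G x) (sumℚ-map-cong xs F≗G)

sumℚ-map-zero : {F : A → ℚ} (xs : List A) → (∀ a → F a ≡ 0ℚ) → sumℚ (map F xs) ≡ 0ℚ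
sumℚ-map-zero [] F≗0 = refl
sumℚ-map-zero (x ∷ xs) F≗0 = cong₂ _+ℚ_ (F≗0 x) (sumℚ-map-zero xs F≗0)

sumℚ-map-neg : (F : A → ℚ) (xs : List A) → sumℚ (map (λ a → - F a) xs) ≡ - sumℚ (map F xs)
sumℚ-map-neg F [] = refl
sumℚ-map-neg F (x ∷ xs) =
  trans (cong (- F x +ℚ_) (sumℚ-map-neg F xs)) (sym (ℚ.neg-distrib-+ (F x) _))

sumℚ-map-+ : (F G : A → ℚ) (xs : List A) →
  sumℚ (map (λ a → F a +ℚ G a) xs) ≡ sumℚ (map F xs) +ℚ sumℚ (map G xs)
sumℚ-map-+ F G [] = refl
sumℚ-map-+ F G (x ∷ xs) =
  trans (cong (F x +ℚ G x +ℚ_) (sumℚ-map-+ F G xs))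
    (solve 4 (λ a b c d → (a :+ b) :+ (c :+ d) := (a :+ c) :+ (b :+ d)) refl (F x) (G x) _ _)
  where open +-*-Solver

sumℚ-map-minus : (F G : A → ℚ) (xs : List A) →
  sumℚ (map (λ a → F a - G a) xs) ≡ sumℚ (map F xs) - sumℚ (map G xs)
sumℚ-map-minus F G xs =
  trans (sumℚ-map-+ F (λ a → - G a) xs) (cong (sumℚ (map F xs) +ℚ_) (sumℚ-map-neg G xs))

nonzeros : (A → ℚ) → List A → ℕ
nonzeros c xs = length (filter (λ a → ¬? (c a ≟ 0ℚ)) xs)

nonzeros-++ : (c : A → ℚ) (xs ys : List A) →
  nonzeros c (xs ++ ys) ≡ nonzeros c xs + nonzeros c ys
nonzeros-++ c xs ys = trans (cong length (filter-++ _ xs ys)) (length-++ (filter _ xs))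

nonzeros-map : (c : A → ℚ) (f : B → A) (xs : List B) → nonzeros c (map f xs) ≡ nonzeros (c ∘ f) xs
nonzeros-map c f [] = refl
nonzeros-map c f (x ∷ xs) with c (f x) ≟ 0ℚ
... | yes _ = nonzeros-map c f xs
... | no _ = cong suc (nonzeros-map c f xs)

∑ : (n : ℕ) → (Subset n → ℚ) → ℚ
∑ n F = sumℚ (map F (allSubsets n))

∑-split : ∀ n (F : Subset (suc n) → ℚ) →
  ∑ (suc n) F ≡ ∑ n (F ∘ (false ∷_)) +ℚ ∑ n (F ∘ (true ∷_))
∑-split n F = begin
  sumℚ (map F (map (false ∷_) Ss ++ map (true ∷_) Ss))
    ≡⟨ cong sumℚ (map-++ F (map (false ∷_) Ss) _) ⟩
  sumℚ (map F (map (false ∷_) Ss) ++ map F (map (true ∷_) Ss))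
    ≡⟨ sumℚ-++ (map F (map (false ∷_) Ss)) _ ⟩
  sumℚ (map F (map (false ∷_) Ss)) +ℚ sumℚ (map F (map (true ∷_) Ss))
    ≡⟨ sym (cong₂ (λ u v → sumℚ u +ℚ sumℚ v) (map-∘ Ss) (map-∘ Ss)) ⟩
  ∑ n (F ∘ (false ∷_)) +ℚ ∑ n (F ∘ (true ∷_)) ∎
  where
  open ≡-Reasoning
  Ss : List (Subset n)
  Ss = allSubsets n

support-split : ∀ {n} (c : Subset (suc n) → ℚ) →
  support c ≡ support (c ∘ (false ∷_)) + support (c ∘ (true ∷_))
support-split {n} c = trans (nonzeros-++ c (map (false ∷_) Ss) _)
  (cong₂ _+_ (nonzeros-map c (false ∷_) Ss) (nonzeros-map c (true ∷_) Ss))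
  where
  Ss : List (Subset n)
  Ss = allSubsets n

_≟ₛ_ : ∀ {n} (S T : Subset n) → Dec (S ≡ T)
_≟ₛ_ = ≡-dec Bool._≟_

δ : ∀ {n} → Subset n → Subset n → ℚ
δ S T = toℚ (does (S ≟ₛ T))

δ-refl : ∀ {n} (T : Subset n) → δ T T ≡ 1ℚ
δ-refl T with T ≟ₛ T
... | yes _ = refl
... | no T≢T = contradiction refl T≢T

δ-≢ : ∀ {n} {S T : Subset n} → S ≢ T → δ S T ≡ 0ℚ
δ-≢ {S = S} {T} S≢T with S ≟ₛ T
... | yes S≡T = contradiction S≡T S≢T
... | no _ = refl

∑-δ : ∀ n (T : Subset n) (g : Subset n → ℚ) → ∑ n (λ S → δ S T *ℚ g S) ≡ g T
∑-δ zero [] g = trans (ℚ.+-identityʳ _) (ℚ.*-identityˡ (g []))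
∑-δ (suc n) (false ∷ T) g = begin
  ∑ (suc n) (λ S → δ S (false ∷ T) *ℚ g S)
    ≡⟨ ∑-split n _ ⟩
  ∑ n (λ S → δ S T *ℚ g (false ∷ S)) +ℚ ∑ n (λ S → 0ℚ *ℚ g (true ∷ S))
    ≡⟨ cong₂ _+ℚ_ (∑-δ n T (g ∘ (false ∷_)))
                  (sumℚ-map-zero (allSubsets n) (λ S → ℚ.*-zeroˡ (g (true ∷ S)))) ⟩
  g (false ∷ T) +ℚ 0ℚ
    ≡⟨ ℚ.+-identityʳ _ ⟩
  g (false ∷ T) ∎
  where open ≡-Reasoning
∑-δ (suc n) (true ∷ T) g = begin
  ∑ (suc n) (λ S → δ S (true ∷ T) *ℚ g S)
    ≡⟨ ∑-split n _ ⟩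
  ∑ n (λ S → 0ℚ *ℚ g (false ∷ S)) +ℚ ∑ n (λ S → δ S T *ℚ g (true ∷ S))
    ≡⟨ cong₂ _+ℚ_ (sumℚ-map-zero (allSubsets n) (λ S → ℚ.*-zeroˡ (g (false ∷ S))))
                  (∑-δ n T (g ∘ (true ∷_))) ⟩
  0ℚ +ℚ g (true ∷ T)
    ≡⟨ ℚ.+-identityˡ _ ⟩
  g (true ∷ T) ∎
  where open ≡-Reasoning

AND-⊥ : ∀ {n} (x : Vec Bool n) → AND ⊥ x ≡ true
AND-⊥ [] = refl
AND-⊥ (_ ∷ x) = AND-⊥ x

AND-⊤ : ∀ {n} (x : Vec Bool n) → AND ⊤ x ≡ maybe (λ _ → false) true (lastZero x)
AND-⊤ [] = refl
AND-⊤ (b ∷ x) with lastZero x | AND-⊤ x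
... | just _ | AND⊤x rewrite AND⊤x = ∧-zeroʳ b
... | nothing | AND⊤x rewrite AND⊤x with b
... | true = refl
... | false = refl

OMB-cons : ∀ {n} b (x : Vec Bool n) →
  toℚ (OMB (suc n) (b ∷ x)) ≡ (1ℚ - toℚ (OMB n x)) - toℚ (b ∧ AND ⊤ x)
OMB-cons b x with lastZero x | AND-⊤ x
... | just k | AND⊤x rewrite AND⊤x | ∧-zeroʳ b | isOdd-suc k =
  sym (trans (ℚ.+-identityʳ _) (1-toℚ≡toℚ-not (isOdd k)))
... | nothing | AND⊤x rewrite AND⊤x with b
... | true = refl
... | false = refl

coeff : (n : ℕ) → Subset n → ℚ
coeff zero [] = 0ℚ
coeff (suc n) (false ∷ S) = δ S ⊥ - coeff n S
coeff (suc n) (true ∷ S) = - δ S ⊤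

coeff-expands : ∀ n → IsANDExpansion (OMB n) (coeff n)
coeff-expands zero [] = refl
coeff-expands (suc n) (b ∷ x) = sym (begin
  ∑ (suc n) (λ S → coeff (suc n) S *ℚ toℚ (AND S (b ∷ x)))
    ≡⟨ ∑-split n _ ⟩
  ∑ n (λ S → (δ S ⊥ - coeff n S) *ℚ a S) +ℚ ∑ n (λ S → - δ S ⊤ *ℚ ba S)
    ≡⟨ cong₂ _+ℚ_ (sumℚ-map-cong Ss (λ S → *-distribʳ-minus (δ S ⊥) (coeff n S) (a S)))
                  (sumℚ-map-cong Ss (λ S → sym (ℚ.neg-distribˡ-* (δ S ⊤) (ba S)))) ⟩
  ∑ n (λ S → δ S ⊥ *ℚ a S - coeff n S *ℚ a S) +ℚ ∑ n (λ S → - (δ S ⊤ *ℚ ba S))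
    ≡⟨ cong₂ _+ℚ_ (sumℚ-map-minus (λ S → δ S ⊥ *ℚ a S) (λ S → coeff n S *ℚ a S) Ss)
                  (sumℚ-map-neg (λ S → δ S ⊤ *ℚ ba S) Ss) ⟩
  (∑ n (λ S → δ S ⊥ *ℚ a S) - ∑ n (λ S → coeff n S *ℚ a S)) - ∑ n (λ S → δ S ⊤ *ℚ ba S)
    ≡⟨ cong₂ (λ u v → (u - v) - ∑ n (λ S → δ S ⊤ *ℚ ba S)) (∑-δ n ⊥ a) (sym (coeff-expands n x)) ⟩
  (toℚ (AND ⊥ x) - toℚ (OMB n x)) - ∑ n (λ S → δ S ⊤ *ℚ ba S)
    ≡⟨ cong₂ (λ u v → (toℚ u - toℚ (OMB n x)) - v) (AND-⊥ x) (∑-δ n ⊤ ba) ⟩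
  (1ℚ - toℚ (OMB n x)) - toℚ (b ∧ AND ⊤ x)
    ≡⟨ sym (OMB-cons b x) ⟩
  toℚ (OMB (suc n) (b ∷ x)) ∎)
  where
  open ≡-Reasoning
  Ss : List (Subset n)
  Ss = allSubsets n
  a ba : Subset n → ℚ
  a S = toℚ (AND S x)
  ba S = toℚ (b ∧ AND S x)

AND-independent : ∀ n (d : Subset n → ℚ) →
  (∀ x → ∑ n (λ S → d S *ℚ toℚ (AND S x)) ≡ 0ℚ) → ∀ S → d S ≡ 0ℚ
AND-independent zero d d·AND≡0 [] =
  trans (sym (trans (ℚ.+-identityʳ _) (ℚ.*-identityʳ (d [])))) (d·AND≡0 [])
AND-independent (suc n) d d·AND≡0 (b ∷ S) = halves b S
  where
  lower upper : Vec Bool n → ℚ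
  lower x = ∑ n (λ S → d (false ∷ S) *ℚ toℚ (AND S x))
  upper x = ∑ n (λ S → d (true ∷ S) *ℚ toℚ (AND S x))

  upper-off : ∀ x → ∑ n (λ S → d (true ∷ S) *ℚ toℚ (false ∧ AND S x)) ≡ 0ℚ
  upper-off x = sumℚ-map-zero (allSubsets n) (λ S → ℚ.*-zeroʳ (d (true ∷ S)))

  lower≡0 : ∀ x → lower x ≡ 0ℚ
  lower≡0 x = begin
    lower x                                             ≡⟨ sym (ℚ.+-identityʳ _) ⟩
    lower x +ℚ 0ℚ                                       ≡⟨ cong (lower x +ℚ_) (sym (upper-off x)) ⟩
    lower x +ℚ ∑ n (λ S → d (true ∷ S) *ℚ toℚ (false ∧ AND S x))
                                                        ≡⟨ sym (∑-split n _) ⟩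
    ∑ (suc n) (λ S → d S *ℚ toℚ (AND S (false ∷ x)))    ≡⟨ d·AND≡0 (false ∷ x) ⟩
    0ℚ ∎
    where open ≡-Reasoning

  upper≡0 : ∀ x → upper x ≡ 0ℚ
  upper≡0 x = begin
    upper x                                             ≡⟨ sym (ℚ.+-identityˡ _) ⟩
    0ℚ +ℚ upper x                                       ≡⟨ cong (_+ℚ upper x) (sym (lower≡0 x)) ⟩
    lower x +ℚ upper x                                  ≡⟨ sym (∑-split n _) ⟩
    ∑ (suc n) (λ S → d S *ℚ toℚ (AND S (true ∷ x)))     ≡⟨ d·AND≡0 (true ∷ x) ⟩
    0ℚ ∎
    where open ≡-Reasoning

  halves : ∀ b S → d (b ∷ S) ≡ 0ℚ
  halves false = AND-independent n (d ∘ (false ∷_)) lower≡0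
  halves true = AND-independent n (d ∘ (true ∷_)) upper≡0

expansion-unique : ∀ {n} {f : Vec Bool n → Bool} {c c' : Subset n → ℚ} →
  IsANDExpansion f c → IsANDExpansion f c' → ∀ S → c S ≡ c' S
expansion-unique {n} {f} {c} {c'} f≡∑c f≡∑c' S =
  x∙y⁻¹≈ε⇒x≈y ℚ.+-0-group (c S) (c' S) (AND-independent n (λ S → c S - c' S) difference≡0 S)
  where
  difference≡0 : ∀ x → ∑ n (λ S → (c S - c' S) *ℚ toℚ (AND S x)) ≡ 0ℚ
  difference≡0 x = begin
    ∑ n (λ S → (c S - c' S) *ℚ toℚ (AND S x))
      ≡⟨ sumℚ-map-cong (allSubsets n) (λ S → *-distribʳ-minus (c S) (c' S) (toℚ (AND S x))) ⟩
    ∑ n (λ S → c S *ℚ toℚ (AND S x) - c' S *ℚ toℚ (AND S x))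
      ≡⟨ sumℚ-map-minus (λ S → c S *ℚ toℚ (AND S x)) (λ S → c' S *ℚ toℚ (AND S x)) (allSubsets n) ⟩
    ∑ n (λ S → c S *ℚ toℚ (AND S x)) - ∑ n (λ S → c' S *ℚ toℚ (AND S x))
      ≡⟨ cong₂ _-_ (sym (f≡∑c x)) (sym (f≡∑c' x)) ⟩
    toℚ (f x) - toℚ (f x)
      ≡⟨ ℚ.+-inverseʳ (toℚ (f x)) ⟩
    0ℚ ∎
    where open ≡-Reasoning

support-≐ : ∀ {n} (c c' : Subset n → ℚ) → (∀ S → (c S ≡ 0ℚ) ⇔ (c' S ≡ 0ℚ)) →
  support c ≡ support c'
support-≐ {n} c c' same = cong length (filter-≐ _ _
  ((λ {S} c≢0 c'≡0 → c≢0 (Equivalence.from (same S) c'≡0)) ,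
   (λ {S} c'≢0 c≡0 → c'≢0 (Equivalence.to (same S) c≡0)))
  (allSubsets n))

support-zero : ∀ {n} (c : Subset n → ℚ) → (∀ S → c S ≡ 0ℚ) → support c ≡ 0
support-zero {n} c c≡0 = cong length
  (filter-none (λ S → ¬? (c S ≟ 0ℚ)) {allSubsets n} (All.tabulate (λ {S} _ c≢0 → c≢0 (c≡0 S))))

support-insert : ∀ {n} (T : Subset n) (c c' : Subset n → ℚ) →
  (∀ S → S ≢ T → (c S ≡ 0ℚ) ⇔ (c' S ≡ 0ℚ)) → c T ≡ 0ℚ → c' T ≢ 0ℚ →
  support c' ≡ suc (support c)
support-insert [] c c' _ cT≡0 c'T≢0 with c [] ≟ 0ℚ | c' [] ≟ 0ℚ
... | yes _ | no _ = refl
... | no cT≢0 | _ = contradiction cT≡0 cT≢0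
... | _ | yes c'T≡0 = contradiction c'T≡0 c'T≢0
support-insert (false ∷ T) c c' same cT≡0 c'T≢0 = begin
  support c'
    ≡⟨ support-split c' ⟩
  support (c' ∘ (false ∷_)) + support (c' ∘ (true ∷_))
    ≡⟨ cong₂ _+_ (support-insert T _ _ (λ S S≢T → same (false ∷ S) (S≢T ∘ ∷-injectiveʳ)) cT≡0 c'T≢0)
                 (sym (support-≐ _ _ (λ S → same (true ∷ S) λ ()))) ⟩
  suc (support (c ∘ (false ∷_)) + support (c ∘ (true ∷_)))
    ≡⟨ cong suc (sym (support-split c)) ⟩
  suc (support c) ∎
  where open ≡-Reasoning
support-insert (true ∷ T) c c' same cT≡0 c'T≢0 = begin
  support c'
    ≡⟨ support-split c' ⟩
  support (c' ∘ (false ∷_)) + support (c' ∘ (true ∷_))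
    ≡⟨ cong₂ _+_ (sym (support-≐ _ _ (λ S → same (false ∷ S) λ ())))
                 (support-insert T _ _ (λ S S≢T → same (true ∷ S) (S≢T ∘ ∷-injectiveʳ)) cT≡0 c'T≢0) ⟩
  support (c ∘ (false ∷_)) + suc (support (c ∘ (true ∷_)))
    ≡⟨ +-suc _ _ ⟩
  suc (support (c ∘ (false ∷_)) + support (c ∘ (true ∷_)))
    ≡⟨ cong suc (sym (support-split c)) ⟩
  suc (support c) ∎
  where open ≡-Reasoning

support-point : ∀ {n} (T : Subset n) (c : Subset n → ℚ) →
  (∀ S → S ≢ T → c S ≡ 0ℚ) → c T ≢ 0ℚ → support c ≡ 1
support-point {n} T c c≡0 cT≢0 =
  trans (support-insert T (λ _ → 0ℚ) c (λ S S≢T → mk⇔ (λ _ → c≡0 S S≢T) (λ _ → refl)) refl cT≢0)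
        (cong suc (support-zero {n} (λ _ → 0ℚ) (λ _ → refl)))

coeff-⊥ : ∀ n → coeff n ⊥ ≡ toℚ (isOdd n)
coeff-⊥ zero = refl
coeff-⊥ (suc n) = begin
  δ (⊥ {n}) ⊥ - coeff n ⊥      ≡⟨ cong₂ _-_ (δ-refl {n} ⊥) (coeff-⊥ n) ⟩
  1ℚ - toℚ (isOdd n)           ≡⟨ 1-toℚ≡toℚ-not (isOdd n) ⟩
  toℚ (not (isOdd n))          ≡⟨ cong toℚ (sym (isOdd-suc n)) ⟩
  toℚ (isOdd (suc n)) ∎
  where open ≡-Reasoning

coeff-suc-zeros : ∀ n S → S ≢ ⊥ → (coeff (suc n) (false ∷ S) ≡ 0ℚ) ⇔ (coeff n S ≡ 0ℚ)
coeff-suc-zeros n S S≢⊥ rewrite δ-≢ S≢⊥ | ℚ.+-identityˡ (- coeff n S) = -≡0⇔≡0 (coeff n S)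

support-coeff-suc : ∀ n → support (coeff (suc n)) ≡ suc (support (coeff (suc n) ∘ (false ∷_)))
support-coeff-suc n = begin
  support (coeff (suc n))
    ≡⟨ support-split (coeff (suc n)) ⟩
  support (coeff (suc n) ∘ (false ∷_)) + support {n} (λ S → - δ S ⊤)
    ≡⟨ cong (support (coeff (suc n) ∘ (false ∷_)) +_) (support-point {n} ⊤ _ -δ≡0 -δ⊤≢0) ⟩
  support (coeff (suc n) ∘ (false ∷_)) + 1
    ≡⟨ +-comm _ 1 ⟩
  suc (support (coeff (suc n) ∘ (false ∷_))) ∎
  where
  open ≡-Reasoning
  -δ≡0 : (S : Subset n) → S ≢ ⊤ → - δ S ⊤ ≡ 0ℚ
  -δ≡0 S S≢⊤ = cong -_ (δ-≢ S≢⊤)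
  -δ⊤≢0 : - δ {n} ⊤ ⊤ ≢ 0ℚ
  -δ⊤≢0 -δ⊤≡0 = 1≢0 (ℚ.neg-injective (trans (sym (cong -_ (δ-refl {n} ⊤))) -δ⊤≡0))

-- Of coeff (suc n) ∘ (false ∷_) and coeff n, which agree in zeros off ⊥, exactly one vanishes
-- at ⊥, depending on the parity of n.
support-coeff : ∀ n → support (coeff n) ≡ (if isOdd n then suc n else n)
support-coeff zero = refl
support-coeff (suc n) rewrite support-coeff-suc n | isOdd-suc n
  with isOdd n in odd | support-coeff n
... | true | ih = trans (sym (support-insert ⊥ _ (coeff n) (coeff-suc-zeros n) lower⊥≡0 coeff⊥≢0)) ih
  where
  coeff⊥≢0 : coeff n ⊥ ≢ 0ℚ
  coeff⊥≢0 = 1≢0 ∘ trans (sym (trans (coeff-⊥ n) (cong toℚ odd)))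
  lower⊥≡0 : coeff (suc n) ⊥ ≡ 0ℚ
  lower⊥≡0 = trans (coeff-⊥ (suc n)) (cong toℚ (trans (isOdd-suc n) (cong not odd)))
... | false | ih = cong suc (trans (support-insert ⊥ (coeff n) _ zeros coeff⊥≡0 lower⊥≢0) (cong suc ih))
  where
  zeros : ∀ S → S ≢ ⊥ → (coeff n S ≡ 0ℚ) ⇔ (coeff (suc n) (false ∷ S) ≡ 0ℚ)
  zeros S S≢⊥ = ⇔-sym (coeff-suc-zeros n S S≢⊥)
  coeff⊥≡0 : coeff n ⊥ ≡ 0ℚ
  coeff⊥≡0 = trans (coeff-⊥ n) (cong toℚ odd)
  lower⊥≢0 : coeff (suc n) ⊥ ≢ 0ℚ
  lower⊥≢0 = 1≢0 ∘ trans (sym (trans (coeff-⊥ (suc n)) (cong toℚ (trans (isOdd-suc n) (cong not odd)))))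

spar-OMB : ∀ n → SparIs (OMB n) (if isOdd n then suc n else n)
spar-OMB n = (coeff n , coeff-expands n) , λ c c-expands →
  let c≗coeff = expansion-unique {c = c} {c' = coeff n} c-expands (coeff-expands n) in
  trans (support-≐ c (coeff n) (λ S → mk⇔ (trans (sym (c≗coeff S))) (trans (c≗coeff S))))
        (support-coeff n)

AND-⁅⁆ : ∀ {n} (i : Fin n) (x : Vec Bool n) → AND ⁅ i ⁆ x ≡ lookup x i
AND-⁅⁆ Fin.zero (b ∷ x) = trans (cong (b ∧_) (AND-⊥ x)) (∧-identityʳ b)
AND-⁅⁆ (Fin.suc i) (_ ∷ x) = AND-⁅⁆ i x

singletons : (n : ℕ) → Vec (Subset n) n
singletons n = tabulate ⁅_⁆

singletons-determine : ∀ n (f : Vec Bool n → Bool) → Determines (singletons n) f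
singletons-determine n f x y same = cong f (begin
  x                    ≡⟨ sym (tabulate∘lookup x) ⟩
  tabulate (lookup x)  ≡⟨ tabulate-cong coordinate ⟩
  tabulate (lookup y)  ≡⟨ tabulate∘lookup y ⟩
  y ∎)
  where
  open ≡-Reasoning
  AND-singleton : ∀ i z → AND (lookup (singletons n) i) z ≡ lookup z i
  AND-singleton i z = trans (cong (λ S → AND S z) (lookup∘tabulate ⁅_⁆ i)) (AND-⁅⁆ i z)
  coordinate : ∀ i → lookup x i ≡ lookup y i
  coordinate i = trans (sym (AND-singleton i x)) (trans (same i) (AND-singleton i y))

zerosThenOnes : (n j : ℕ) → Vec Bool n
zerosThenOnes zero _ = []
zerosThenOnes (suc n) zero = true ∷ zerosThenOnes n zero
zerosThenOnes (suc n) (suc j) = false ∷ zerosThenOnes n j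

lastZero-ones : ∀ n → lastZero (zerosThenOnes n 0) ≡ nothing
lastZero-ones zero = refl
lastZero-ones (suc n) rewrite lastZero-ones n = refl

lastZero-zerosThenOnes : ∀ n j → suc j ≤ n → lastZero (zerosThenOnes n (suc j)) ≡ just (suc j)
lastZero-zerosThenOnes (suc n) zero _ rewrite lastZero-ones n = refl
lastZero-zerosThenOnes (suc n) (suc j) (s≤s j<n) rewrite lastZero-zerosThenOnes n j j<n = refl

OMB-zerosThenOnes : ∀ n j → j ≤ n → OMB n (zerosThenOnes n j) ≡ isOdd j
OMB-zerosThenOnes n zero _ = cong (maybe isOdd false) (lastZero-ones n)
OMB-zerosThenOnes n (suc j) j<n = cong (maybe isOdd false) (lastZero-zerosThenOnes n j j<n)

AND-ones : ∀ n (S : Subset n) → AND S (zerosThenOnes n 0) ≡ true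
AND-ones zero [] = refl
AND-ones (suc n) (true ∷ S) = AND-ones n S
AND-ones (suc n) (false ∷ S) = AND-ones n S

AND-zerosThenOnes-antitone : ∀ n (S : Subset n) j j' → j ≤ j' →
  AND S (zerosThenOnes n j') ≡ true → AND S (zerosThenOnes n j) ≡ true
AND-zerosThenOnes-antitone zero [] _ _ _ _ = refl
AND-zerosThenOnes-antitone (suc n) S zero _ _ _ = AND-ones (suc n) S
AND-zerosThenOnes-antitone (suc n) (false ∷ S) (suc j) (suc j') (s≤s j≤j') =
  AND-zerosThenOnes-antitone n S j j' j≤j'
AND-zerosThenOnes-antitone (suc n) (true ∷ S) (suc j) (suc j') _ ()

Flips : ∀ n → Subset n → ℕ → Set
Flips n S j = AND S (zerosThenOnes n j) ≢ AND S (zerosThenOnes n (suc j))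

flips-downward : ∀ n S {j} → Flips n S j →
  AND S (zerosThenOnes n j) ≡ true × AND S (zerosThenOnes n (suc j)) ≡ false
flips-downward n S {j} flips
  with AND S (zerosThenOnes n j) | AND S (zerosThenOnes n (suc j))
     | AND-zerosThenOnes-antitone n S j (suc j) (n≤1+n j)
... | true | false | _ = refl , refl
... | true | true | _ = contradiction refl flips
... | false | false | _ = contradiction refl flips
... | false | true | antitone = case antitone refl of λ ()

flips-unique : ∀ n S {j j'} → Flips n S j → Flips n S j' → j ≡ j'
flips-unique n S flips flips' =
  ≤-antisym (≮⇒≥ (no-later-flip flips' flips)) (≮⇒≥ (no-later-flip flips flips'))
  where
  no-later-flip : ∀ {j j'} → Flips n S j → Flips n S j' → ¬ j < j'
  no-later-flip {j} {j'} flips flips' j<j' =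
    case trans (sym (proj₂ (flips-downward n S flips)))
               (AND-zerosThenOnes-antitone n S (suc j) j' j<j' (proj₁ (flips-downward n S flips')))
    of λ ()

determines-OMB⇒≤ : ∀ n k (Ss : Vec (Subset n) k) → Determines Ss (OMB n) → n ≤ k
determines-OMB⇒≤ n k Ss determines = injective⇒≤ {f = query} query-injective
  where
  flipping-query : (i : Fin n) → ∃ λ t → Flips n (lookup Ss t) (toℕ i)
  flipping-query i =
    ¬∀⟶∃¬ k _ (λ t → AND (lookup Ss t) _ Bool.≟ AND (lookup Ss t) _) λ none-flips →
      not-¬ refl (begin
        isOdd (toℕ i)                          ≡⟨ sym (OMB-zerosThenOnes n (toℕ i) (<⇒≤ (toℕ<n i))) ⟩
        OMB n (zerosThenOnes n (toℕ i))        ≡⟨ determines _ _ none-flips ⟩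
        OMB n (zerosThenOnes n (suc (toℕ i)))  ≡⟨ OMB-zerosThenOnes n (suc (toℕ i)) (toℕ<n i) ⟩
        isOdd (suc (toℕ i))                    ≡⟨ isOdd-suc (toℕ i) ⟩
        not (isOdd (toℕ i)) ∎)
    where open ≡-Reasoning
  query : Fin n → Fin k
  query = proj₁ ∘ flipping-query
  query-injective : ∀ {i i'} → query i ≡ query i' → i ≡ i'
  query-injective {i} {i'} same = toℕ-injective (flips-unique n (lookup Ss (query i'))
    (subst (λ t → Flips n (lookup Ss t) (toℕ i)) same (proj₂ (flipping-query i)))
    (proj₂ (flipping-query i')))

claim10 : (n : ℕ) → 1 Data.Nat.≤ n →
    NAADTIs (OMB n) n ×
    (2 ∣ n → SparIs (OMB n) n) ×
    (¬ (2 ∣ n) → SparIs (OMB n) (n + 1))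
claim10 n _ =
  ((singletons n , singletons-determine n (OMB n)) , determines-OMB⇒≤ n) ,
  (λ 2∣n → subst (SparIs (OMB n)) (even-count 2∣n) (spar-OMB n)) ,
  (λ 2∤n → subst (SparIs (OMB n)) (odd-count 2∤n) (spar-OMB n))
  where
  even-count : 2 ∣ n → (if isOdd n then suc n else n) ≡ n
  even-count 2∣n rewrite 2∣n⇒isOdd≡false 2∣n = refl
  odd-count : ¬ 2 ∣ n → (if isOdd n then suc n else n) ≡ n + 1
  odd-count 2∤n rewrite 2∤n⇒isOdd≡true 2∤n = +-comm 1 n
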